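{- Let $\mathbf{u}=\lim_{k\to\infty}\varphi^k(0)$ be a Parry word with associated constant $R$, and let $F_j=|\varphi^j(0)|$. Let $n\in\mathbb{N}$ have normal $F$-representation $\langle n\rangle_F=(d_{k+K-1},\dots,d_k,d_{k-1},\dots,d_0)$ with $k,K\ge1$, and let $Q,q$ be the integers with normal $F$-representations $\langle Q\rangle_F=(d_{k+K-1},\dots,d_k)$ and $\langle q\rangle_F=(d_{k-1},\dots,d_0)$. Let $\mathcal{Z}$ be an abelian co-decomposition of the pair $\binom{\varphi^{K+R}(0)}{\mathbf{u}_{[Q]}^{ -1}\varphi^{K+R}(0)\mathbf{u}_{[Q]}}$ (i.e. of $\binom{\mathbf{u}_{[B]}\mathbf{u}_{[Q]}^{ -1}}{\mathbf{u}_{[Q]}^{ -1}\mathbf{u}_{[B]}}$ with $\mathbf{u}_{[B]}=\varphi^{K+R}(0)\mathbf{u}_{[Q]}$) such that $\varphi^k(\tilde z)$ has the prefix $\mathbf{u}_{[q]}$ for every $\binom{z}{\tilde z}\in\mathcal{Z}$. Then for each $\binom{z}{\tilde z}\in\mathcal{Z}$ the words $\varphi^k(z)$ and $\mathbf{u}_{[q]}^{ -1}\varphi^k(\tilde z)\mathbf{u}_{[q]}$ have equal Parikh vectors, and for any choice of abelian co-decompositions $D_{(z,\tilde z)}$ of the pairs $\binom{\varphi^k(z)}{\mathbf{u}_{[q]}^{ -1}\varphi^k(\tilde z)\mathbf{u}_{[q]}}$, the set $\bigcup_{\binom{z}{\tilde z}\in\mathcal{Z}}D_{(z,\tilde z)}$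 is an abelian co-decomposition of the pair $\binom{\varphi^{k+K+R}(0)}{\mathbf{u}_{[n]}^{ -1}\varphi^{k+K+R}(0)\mathbf{u}_{[n]}}$ (i.e. of $\binom{\mathbf{u}_{[B']}\mathbf{u}_{[n]}^{ -1}}{\mathbf{u}_{[n]}^{ -1}\mathbf{u}_{[B']}}$ with $\mathbf{u}_{[B']}=\varphi^{k+K+R}(0)\mathbf{u}_{[n]}$).
   Context: A Parry word is the fixed point $\mathbf{u}=\lim_k\varphi^k(0)$ of a substitution of one of two types. Simple type ($m\ge1$): alphabet $\{0,\dots,m-1\}$, $\varphi(\ell)=0^{\alpha_\ell}(\ell+1)$ for $\ell\le m-2$, $\varphi(m-1)=0^{\alpha_{m-1}}$, with $\alpha_{m-1}\ge1$, $\alpha_i\cdots\alpha_{m-1}0^\omega<_{\mathrm{lex}}\alpha_0\cdots\alpha_{m-1}0^\omega$ for $1\le i\le m-1$, some image of length $>1$. Non-simple type ($m,p\ge1$): alphabet $\{0,\dots,m+p-1\}$, $\varphi(\ell)=0^{\alpha_\ell}(\ell+1)$ for $\ell\le m+p-2$, $\varphi(m+p-1)=0^{\alpha_{m+p-1}}m$, with $d=\alpha_0\cdots\alpha_{m-1}(\alpha_m\cdots\alpha_{m+p-1})^\omega$ not ending in $0^\omega$, $m,p$ minimal, every shift $\alpha_i\alpha_{i+1}\cdots$ ($i\ge1$) lexicographically strictly smaller than $d$. Associated constant: simple type $R=m-1$ if $\alpha_0\ge2$, $R=m+\ell'-1$ with $\ell'=\min\{\ell\ge1:\alpha_\ell\ge1\}$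 if $\alpha_0=1$; non-simple type, with $h'=\min\{\ell\ge m:\alpha_\ell\ge1\}$, $R=h'+p$ if $\alpha_0\ge2$ and $R=h'+m+p-1$ if $\alpha_0=1$. Normal $F$-representation of $n\in\mathbb{N}_0$: the digits $(d_N,\dots,d_0)$, $n=\sum d_iF_i$, produced by the greedy algorithm (choose $N$ with $n<F_{N+1}$, $x_N=n$, $d_i=\lfloor x_i/F_i\rfloor$, $x_{i-1}=x_i-d_iF_i$); leading zeros are allowed. $\mathbf{u}_{[n]}$ is the prefix of length $n$; $x^{ -1}(xv)=v$, $(vx)x^{ -1}=v$. Parikh vector $\Psi(w)=(|w|_\ell)_\ell$. Abelian co-decomposition of $\binom{v}{w}$ with $\Psi(v)=\Psi(w)$: the set of pairs $\{\binom{z_j}{\tilde z_j}\}_{j=0}^h$ arising from factorizations $v=z_0\cdots z_h$, $w=\tilde z_0\cdots\tilde z_h$ with nonempty factors and $\Psi(z_j)=\Psi(\tilde z_j)$ for all $j$. -}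

module Defs where

open import Data.Nat using (ℕ; zero; suc; _+_; _*_; _∸_; _≤_; _<_; _<ᵇ_; _%_; NonZero)
open import Data.Nat.Properties using (_≟_)
open import Data.Bool using (if_then_else_)
open import Data.List using (List; []; _∷_; [_]; _++_; replicate; concatMap; concat; map; length; filter; take)
open import Data.List.Relation.Unary.All using (All)
open import Data.Product using (Σ; ∃; _×_; _,_; proj₁; proj₂)
open import Data.Sum using (_⊎_)
open import Relation.Binary.PropositionalEquality using (_≡_)
open import Relation.Nullary using (¬_)

Word : Set
Word = List ℕ

-- Parry substitution data.  The coefficients α_ℓ are given by a function
-- α : ℕ → ℕ; only α 0, …, α (m-1)  (resp. α (m+p-1)) are meaningful.
data Parry : Set where
  simple    : (m : ℕ) (α : ℕ → ℕ) → Parry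
  nonSimple : (m p : ℕ) .{{_ : NonZero p}} (α : ℕ → ℕ) → Parry

φ : Parry → ℕ → Word
φ (simple m α) ℓ =
  replicate (α ℓ) 0 ++ (if suc ℓ <ᵇ m then [ suc ℓ ] else [])
φ (nonSimple m p α) ℓ =
  replicate (α ℓ) 0 ++ [ (if suc ℓ <ᵇ m + p then suc ℓ else m) ]

φ* : Parry → Word → Word
φ* P w = concatMap (φ P) w

φ^ : Parry → ℕ → Word → Word
φ^ P zero    w = w
φ^ P (suc j) w = φ* P (φ^ P j w)

F : Parry → ℕ → ℕ
F P j = length (φ^ P j [ 0 ])

-- u_[n] : prefix of length n of the fixed point u = lim φ^k(0).
-- (φ^n(0) is a prefix of u of length F_n ≥ n+1, so this is the prefix of u.)
pref : Parry → ℕ → Word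
pref P n = take n (φ^ P n [ 0 ])

LexLt : (ℕ → ℕ) → (ℕ → ℕ) → Set
LexLt a b = ∃ λ k → (∀ j → j < k → a j ≡ b j) × a k < b k

finSeq : ℕ → (ℕ → ℕ) → ℕ → ℕ
finSeq m α j = if j <ᵇ m then α j else 0

perSeq : (m p : ℕ) .{{_ : NonZero p}} → (ℕ → ℕ) → ℕ → ℕ
perSeq m p α j = if j <ᵇ m then α j else α (m + ((j ∸ m) % p))

IsParry : Parry → Set
IsParry P@(simple m α) =
  1 ≤ m
  × 1 ≤ α (m ∸ 1)
  × (∀ i → 1 ≤ i → i ≤ m ∸ 1 →
       LexLt (λ j → finSeq m α (i + j)) (finSeq m α))
  × (∃ λ ℓ → ℓ < m × 1 < length (φ P ℓ))
IsParry (nonSimple m p α) =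
  1 ≤ m
  × ¬ (∃ λ N → ∀ j → N ≤ j → perSeq m p α j ≡ 0)
  -- minimality of (m , p)
  × (∀ m' p' → 1 ≤ m' → 1 ≤ p' →
       (∀ j → m' ≤ j → perSeq m p α (p' + j) ≡ perSeq m p α j) →
       m ≤ m' × p ≤ p')
  × (∀ i → 1 ≤ i → LexLt (λ j → perSeq m p α (i + j)) (perSeq m p α))

AssocConst : Parry → ℕ → Set
AssocConst (simple m α) R =
  (2 ≤ α 0 × R ≡ m ∸ 1)
  ⊎ (α 0 ≡ 1 × ∃ λ ℓ' →
        (1 ≤ ℓ' × ℓ' < m × 1 ≤ α ℓ' × (∀ ℓ → 1 ≤ ℓ → ℓ < ℓ' → α ℓ ≡ 0))
        × R ≡ m + ℓ' ∸ 1)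
AssocConst (nonSimple m p α) R =
  ∃ λ h' → (m ≤ h' × 1 ≤ perSeq m p α h'
             × (∀ ℓ → m ≤ ℓ → ℓ < h' → perSeq m p α ℓ ≡ 0))
           × ((2 ≤ α 0 × R ≡ h' + p) ⊎ (α 0 ≡ 1 × R ≡ h' + m + p ∸ 1))

-- greedy algorithm: Greedy P i x ds  means that, starting from x_{i-1} = x,
-- the greedy algorithm outputs the digits ds = (d_{i-1}, …, d_0), where
-- d_j = ⌊x_j / F_j⌋ (i.e. d_j F_j ≤ x_j < (d_j+1) F_j) and x_{j-1} = x_j − d_j F_j.
data Greedy (P : Parry) : ℕ → ℕ → List ℕ → Set where
  done : ∀ {x} → Greedy P zero x []
  step : ∀ {i x d ds} →
         d * F P i ≤ x → x < suc d * F P i →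
         Greedy P i (x ∸ d * F P i) ds →
         Greedy P (suc i) x (d ∷ ds)

-- ⟨n⟩_F = ds  (most significant digit first, leading zeros allowed):
-- N = length ds − 1 with n < F_{N+1}, and ds is the greedy output.
NormalRep : Parry → ℕ → List ℕ → Set
NormalRep P n ds = n < F P (length ds) × Greedy P (length ds) n ds

Ψ : Word → ℕ → ℕ
Ψ w ℓ = length (filter (_≟ ℓ) w)

ParikhEq : Word → Word → Set
ParikhEq v w = ∀ ℓ → Ψ v ℓ ≡ Ψ w ℓ

NonEmpty : Word → Set
NonEmpty w = 1 ≤ length w

IsCoDec : Word → Word → List (Word × Word) → Set
IsCoDec v w Z =
  1 ≤ length Z
  × concat (map proj₁ Z) ≡ v
  × concat (map proj₂ Z) ≡ w
  × All (λ zz → NonEmpty (proj₁ zz) × NonEmpty (proj₂ zz)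
                 × ParikhEq (proj₁ zz) (proj₂ zz)) Z

IsPrefix : Word → Word → Set
IsPrefix x w = ∃ λ s → x ++ s ≡ w

module Submission where

-- Write U = u_[Q], V = u_[q], W = φ^{K+R}(0) and h = φ^k.  The proof has two parts.
--
-- (1) Numeration.  For a normal F-representation (d_{N-1},…,d_0) of n, the prefix u_[n]
--     equals φ^{N-1}(0)^{d_{N-1}} ⋯ φ^0(0)^{d_0}.  This rests on the "tail words"
--     T_i(j) = φ^i(λ_j), where λ_j is the state reached after j steps of the automaton
--     underlying φ: they satisfy T_{i+1}(j) = φ^i(0)^{c_j} T_i(j+1), and the
--     lexicographic admissibility of (c_j) bounds |T_i(j)| ≤ F_i, which is exactly what
--     makes the greedy digits read off a prefix of T_N(0) = φ^N(0).  Splitting the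
--     digit string as hi ++ lo then gives  u_[n] = h(U) V.
--
-- (2) Combinatorics on words.  Since U is a prefix of W (Q < F_K ≤ F_{K+R}), a
--     co-decomposition Z of (W , U⁻¹WU) is pushed through the morphism h: each pair
--     (h z , V⁻¹h(z̃)V) is abelian-equivalent (h preserves permutations), the conjugated
--     right halves telescope to V⁻¹h(U⁻¹WU)V, and the concatenation of co-decompositions
--     of the pieces co-decomposes (h W , V⁻¹h(U⁻¹WU)V) = (φ^{k+K+R}(0) , u_[n]⁻¹φ^{k+K+R}(0)u_[n]).

open import Defs
open import Data.Bool using (true; false; if_then_else_)
open import Data.Empty using (⊥-elim)
open import Data.List using (List; []; _∷_; [_]; _++_; length; drop; take; concat; map; replicate)
open import Data.List.Properties using (++-assoc; ++-identityʳ; length-++; map-++; concat-++; length-take; take++drop≡id; filter-accept; filter-reject)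
open import Data.List.Relation.Unary.All using (All; []; _∷_)
import Data.List.Relation.Unary.All.Properties as All
open import Data.List.Relation.Binary.Pointwise using (Pointwise; []; _∷_)
open import Data.List.Relation.Binary.Permutation.Propositional using (_↭_; ↭-refl; ↭-sym; ↭-trans; ↭-reflexive; prep; swap)
import Data.List.Relation.Binary.Permutation.Propositional as Perm
open import Data.List.Relation.Binary.Permutation.Propositional.Properties using (filter-↭; ↭-length; ++⁺ˡ; shift; shifts; ++-comm)
open import Data.Nat using (ℕ; zero; suc; _+_; _*_; _∸_; _≤_; _<_; _<ᵇ_; _%_; _/_; NonZero; >-nonZero⁻¹; z≤n; s≤s; _<?_)
open import Data.Nat.Properties
open import Data.Nat.DivMod using (m≡m%n+[m/n]*n; [m+kn]%n≡m%n; m%n<n; m<n⇒m%n≡m; n%n≡0)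
open import Data.Product using (Σ; _×_; _,_; proj₁; proj₂)
open import Data.Sum using (_⊎_; inj₁; inj₂)
open import Relation.Nullary using (yes; no)
open import Relation.Nullary.Reflects using (ofʸ; ofⁿ)
open import Relation.Binary.PropositionalEquality using (_≡_; refl; sym; trans; cong; cong₂; subst; subst₂; module ≡-Reasoning)

if-<ᵇ-yes : ∀ {A : Set} {x y : ℕ} (a b : A) → x < y → (if x <ᵇ y then a else b) ≡ a
if-<ᵇ-yes {x = x} {y} a b x<y with x <ᵇ y | <ᵇ-reflects-< x y
... | true  | _        = refl
... | false | ofⁿ x≮y = ⊥-elim (x≮y x<y)

if-<ᵇ-no : ∀ {A : Set} {x y : ℕ} (a b : A) → y ≤ x → (if x <ᵇ y then a else b) ≡ b
if-<ᵇ-no {x = x} {y} a b y≤x with x <ᵇ y | <ᵇ-reflects-< x y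
... | true  | ofʸ x<y = ⊥-elim (<⇒≱ x<y y≤x)
... | false | _        = refl

rep : ℕ → Word → Word
rep d w = concat (replicate d w)

length-rep : ∀ d (w : Word) → length (rep d w) ≡ d * length w
length-rep zero    w = refl
length-rep (suc d) w = trans (length-++ w) (cong (length w +_) (length-rep d w))

rep-[0] : ∀ c → rep c [ 0 ] ≡ replicate c 0
rep-[0] zero    = refl
rep-[0] (suc c) = cong (0 ∷_) (rep-[0] c)

take-++-length : ∀ (xs ys : Word) r → take (length xs + r) (xs ++ ys) ≡ xs ++ take r ys
take-++-length []       ys r = refl
take-++-length (x ∷ xs) ys r = cong (x ∷_) (take-++-length xs ys r)

take-++-short : ∀ (xs ys : Word) r → r ≤ length xs → take r (xs ++ ys) ≡ take r xs
take-++-short xs       ys zero    _         = refl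
take-++-short (x ∷ xs) ys (suc r) (s≤s r≤) = cong (x ∷_) (take-++-short xs ys r r≤)

drop-++-length : ∀ (xs ys : Word) r → drop (length xs + r) (xs ++ ys) ≡ drop r ys
drop-++-length []       ys r = refl
drop-++-length (x ∷ xs) ys r = drop-++-length xs ys r

drop-++-exact : ∀ (xs ys : Word) n → length xs ≡ n → drop n (xs ++ ys) ≡ ys
drop-++-exact []       ys zero    _ = refl
drop-++-exact (x ∷ xs) ys (suc n) e = drop-++-exact xs ys n (suc-injective e)

drop-conjugate : ∀ (V s w : Word) q → length V ≡ q → V ++ s ≡ w → drop q (w ++ V) ≡ s ++ V
drop-conjugate V s w q |V| refl = trans (cong (drop q) (++-assoc V s V)) (drop-++-exact V (s ++ V) q |V|)

take-rep-inside : ∀ d s (w rest : Word) r → d < s → r ≤ length w →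
                  take (d * length w + r) (rep s w ++ rest) ≡ rep d w ++ take r w
take-rep-inside zero    (suc s) w rest r _ r≤ =
  trans (cong (take r) (++-assoc w (rep s w) rest)) (take-++-short w _ r r≤)
take-rep-inside (suc d) (suc s) w rest r (s≤s d<s) r≤ = begin
    take (length w + d * length w + r) ((w ++ rep s w) ++ rest)
  ≡⟨ cong₂ take (+-assoc (length w) (d * length w) r) (++-assoc w (rep s w) rest) ⟩
    take (length w + (d * length w + r)) (w ++ (rep s w ++ rest))
  ≡⟨ take-++-length w _ _ ⟩
    w ++ take (d * length w + r) (rep s w ++ rest)
  ≡⟨ cong (w ++_) (take-rep-inside d s w rest r d<s r≤) ⟩
    w ++ (rep d w ++ take r w)
  ≡⟨ ++-assoc w (rep d w) (take r w) ⟨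
    (w ++ rep d w) ++ take r w
  ∎
  where open ≡-Reasoning

take-rep-after : ∀ s (w rest : Word) r → take (s * length w + r) (rep s w ++ rest) ≡ rep s w ++ take r rest
take-rep-after s w rest r =
  trans (cong (λ l → take (l + r) (rep s w ++ rest)) (sym (length-rep s w))) (take-++-length (rep s w) rest r)

drop-rotate : ∀ (A B V : Word) n → n ≡ length A + length V →
              drop n ((A ++ B) ++ (A ++ V)) ≡ drop (length V) ((B ++ A) ++ V)
drop-rotate A B V n refl = begin
    drop (length A + length V) ((A ++ B) ++ (A ++ V))
  ≡⟨ cong (drop (length A + length V)) (++-assoc A B (A ++ V)) ⟩
    drop (length A + length V) (A ++ (B ++ (A ++ V)))
  ≡⟨ drop-++-length A _ (length V) ⟩
    drop (length V) (B ++ (A ++ V))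
  ≡⟨ cong (drop (length V)) (++-assoc B A V) ⟨
    drop (length V) ((B ++ A) ++ V)
  ∎
  where open ≡-Reasoning

module Morphism (P : Parry) where

  φ*-++ : ∀ a b → φ* P (a ++ b) ≡ φ* P a ++ φ* P b
  φ*-++ []      b = refl
  φ*-++ (x ∷ a) b = trans (cong (φ P x ++_) (φ*-++ a b)) (sym (++-assoc (φ P x) _ _))

  φ^-[] : ∀ i → φ^ P i [] ≡ []
  φ^-[] zero    = refl
  φ^-[] (suc i) = cong (φ* P) (φ^-[] i)

  φ^-++ : ∀ i a b → φ^ P i (a ++ b) ≡ φ^ P i a ++ φ^ P i b
  φ^-++ zero    a b = refl
  φ^-++ (suc i) a b = trans (cong (φ* P) (φ^-++ i a b)) (φ*-++ (φ^ P i a) (φ^ P i b))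

  φ^-rep : ∀ i d w → φ^ P i (rep d w) ≡ rep d (φ^ P i w)
  φ^-rep i zero    w = φ^-[] i
  φ^-rep i (suc d) w = trans (φ^-++ i w (rep d w)) (cong (φ^ P i w ++_) (φ^-rep i d w))

  φ^-+ : ∀ k j w → φ^ P k (φ^ P j w) ≡ φ^ P (k + j) w
  φ^-+ zero    j w = refl
  φ^-+ (suc k) j w = cong (φ* P) (φ^-+ k j w)

  φ^-suc : ∀ i w → φ^ P (suc i) w ≡ φ^ P i (φ* P w)
  φ^-suc zero    w = refl
  φ^-suc (suc i) w = cong (φ* P) (φ^-suc i w)

↭⇒ParikhEq : ∀ {v w} → v ↭ w → ParikhEq v w
↭⇒ParikhEq v↭w ℓ = ↭-length (filter-↭ (_≟ ℓ) v↭w)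

Ψ-head : ∀ a w → Ψ (a ∷ w) a ≡ suc (Ψ w a)
Ψ-head a w = cong length (filter-accept (_≟ a) {xs = w} refl)

Ψ-cancel-head : ∀ a v w → ParikhEq (a ∷ v) (a ∷ w) → ParikhEq v w
Ψ-cancel-head a v w pe ℓ with a ≟ ℓ
... | yes a≡ℓ = suc-injective (subst₂ _≡_ (cong length (filter-accept (_≟ ℓ) {xs = v} a≡ℓ))
                                          (cong length (filter-accept (_≟ ℓ) {xs = w} a≡ℓ)) (pe ℓ))
... | no  a≢ℓ = subst₂ _≡_ (cong length (filter-reject (_≟ ℓ) {xs = v} a≢ℓ))
                           (cong length (filter-reject (_≟ ℓ) {xs = w} a≢ℓ)) (pe ℓ)

split-at : ∀ a w → 1 ≤ Ψ w a → Σ Word λ w₁ → Σ Word λ w₂ → w ≡ w₁ ++ a ∷ w₂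
split-at a (b ∷ w) occ with b ≟ a
... | yes refl = [] , w , refl
... | no  b≢a with split-at a w (subst (1 ≤_) (cong length (filter-reject (_≟ a) {xs = w} b≢a)) occ)
...   | w₁ , w₂ , refl = b ∷ w₁ , w₂ , refl

ParikhEq⇒↭ : ∀ v w → ParikhEq v w → v ↭ w
ParikhEq⇒↭ []      []      _  = ↭-refl
ParikhEq⇒↭ []      (b ∷ w) pe = ⊥-elim (0≢1+n (trans (pe b) (Ψ-head b w)))
ParikhEq⇒↭ (a ∷ v) w       pe with split-at a w (subst (1 ≤_) (trans (sym (Ψ-head a v)) (pe a)) (s≤s z≤n))
... | w₁ , w₂ , refl = ↭-trans (prep a (ParikhEq⇒↭ v (w₁ ++ w₂) pe′)) (↭-sym (shift a w₁ w₂))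
  where
  pe′ : ParikhEq v (w₁ ++ w₂)
  pe′ = Ψ-cancel-head a v (w₁ ++ w₂) (λ ℓ → trans (pe ℓ) (↭⇒ParikhEq (shift a w₁ w₂) ℓ))

module Permute (P : Parry) where

  φ*-↭ : ∀ {v w} → v ↭ w → φ* P v ↭ φ* P w
  φ*-↭ Perm.refl        = ↭-refl
  φ*-↭ (prep x p)       = ++⁺ˡ (φ P x) (φ*-↭ p)
  φ*-↭ (swap x y p)     = ↭-trans (shifts (φ P x) (φ P y)) (++⁺ˡ (φ P y) (++⁺ˡ (φ P x) (φ*-↭ p)))
  φ*-↭ (Perm.trans p q) = ↭-trans (φ*-↭ p) (φ*-↭ q)

  φ^-↭ : ∀ k {v w} → v ↭ w → φ^ P k v ↭ φ^ P k w
  φ^-↭ zero    p = p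
  φ^-↭ (suc k) p = φ*-↭ (φ^-↭ k p)

-- The automaton underlying φ.  φ(λ_j) = 0^{c_j} λ_{j+1}, where λ_j is the state after
-- j steps (a letter, or nothing once a simple automaton has stopped) and c_j is the
-- j-th term of the sequence finSeq / perSeq governing admissibility.

-- closed form of the j-th state of 0 → 1 → ⋯ → m+p-1 → m (a cycle of length p)
cycleState : (m p : ℕ) .{{_ : NonZero p}} → ℕ → ℕ
cycleState m p j = if j <ᵇ m then j else m + (j ∸ m) % p

-- the successor of a state, as in the last letter of φ(ℓ) for a non-simple Parry word
nextState : (m p : ℕ) → ℕ → ℕ
nextState m p ℓ = if suc ℓ <ᵇ m + p then suc ℓ else m

suc-% : ∀ x p .{{_ : NonZero p}} → suc x % p ≡ suc (x % p) % p
suc-% x p = trans (cong (λ y → suc y % p) (m≡m%n+[m/n]*n x p)) ([m+kn]%n≡m%n (suc (x % p)) (x / p) p)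

cycleState-suc : ∀ m p .{{_ : NonZero p}} j → m ≤ j → cycleState m p (suc j) ≡ m + suc (j ∸ m) % p
cycleState-suc m p j m≤j =
  trans (if-<ᵇ-no _ _ (≤-trans m≤j (n≤1+n j))) (cong (λ x → m + x % p) (+-∸-assoc 1 m≤j))

nextState-cycle : ∀ m p .{{_ : NonZero p}} j → nextState m p (cycleState m p j) ≡ cycleState m p (suc j)
nextState-cycle m p j with j <ᵇ m | <ᵇ-reflects-< j m
... | true | ofʸ j<m with m≤n⇒m<n∨m≡n j<m
...   | inj₁ 1+j<m = trans (if-<ᵇ-yes _ _ (≤-trans 1+j<m (m≤m+n m p))) (sym (if-<ᵇ-yes _ _ 1+j<m))
...   | inj₂ refl  = begin
        nextState (suc j) p j
      ≡⟨ if-<ᵇ-yes _ _ (m<m+n (suc j) (>-nonZero⁻¹ p)) ⟩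
        suc j
      ≡⟨ +-identityʳ (suc j) ⟨
        suc j + 0
      ≡⟨ cong (suc j +_) (trans (cong (_% p) (n∸n≡0 (suc j))) (m<n⇒m%n≡m (>-nonZero⁻¹ p))) ⟨
        suc j + (suc j ∸ suc j) % p
      ≡⟨ if-<ᵇ-no {x = j} {y = j} (suc j) _ ≤-refl ⟨
        cycleState (suc j) p (suc j)
      ∎
  where open ≡-Reasoning
nextState-cycle m p j | false | ofⁿ j≮m with m≤n⇒m<n∨m≡n (m%n<n (j ∸ m) p)
... | inj₁ 1+r<p = begin
    nextState m p (m + r)
  ≡⟨ if-<ᵇ-yes _ _ (subst (_< m + p) (+-suc m r) (+-monoʳ-< m 1+r<p)) ⟩
    suc (m + r)
  ≡⟨ +-suc m r ⟨
    m + suc r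
  ≡⟨ cong (m +_) (trans (suc-% (j ∸ m) p) (m<n⇒m%n≡m 1+r<p)) ⟨
    m + suc (j ∸ m) % p
  ≡⟨ cycleState-suc m p j (≮⇒≥ j≮m) ⟨
    cycleState m p (suc j)
  ∎
  where
  open ≡-Reasoning
  r : ℕ
  r = (j ∸ m) % p
... | inj₂ 1+r≡p = begin
    nextState m p (m + r)
  ≡⟨ if-<ᵇ-no _ _ (≤-reflexive (trans (cong (m +_) (sym 1+r≡p)) (+-suc m r))) ⟩
    m
  ≡⟨ +-identityʳ m ⟨
    m + 0
  ≡⟨ cong (m +_) (trans (suc-% (j ∸ m) p) (trans (cong (_% p) 1+r≡p) (n%n≡0 p))) ⟨
    m + suc (j ∸ m) % p
  ≡⟨ cycleState-suc m p j (≮⇒≥ j≮m) ⟨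
    cycleState m p (suc j)
  ∎
  where
  open ≡-Reasoning
  r : ℕ
  r = (j ∸ m) % p

perSeq-cycle : ∀ m p .{{_ : NonZero p}} (α : ℕ → ℕ) j → perSeq m p α j ≡ α (cycleState m p j)
perSeq-cycle m p α j with j <ᵇ m
... | true  = refl
... | false = refl

state : Parry → ℕ → Word
state (simple m α)      j = if j <ᵇ m then [ j ] else []
state (nonSimple m p α) j = [ cycleState m p j ]

coeff : Parry → ℕ → ℕ
coeff (simple m α)      = finSeq m α
coeff (nonSimple m p α) = perSeq m p α

φ*-state : ∀ P j → φ* P (state P j) ≡ replicate (coeff P j) 0 ++ state P (suc j)
φ*-state (simple m α) j with j <ᵇ m | <ᵇ-reflects-< j m
... | true  | _        = ++-identityʳ _
... | false | ofⁿ j≮m = sym (if-<ᵇ-no _ _ (≤-trans (≮⇒≥ j≮m) (n≤1+n j)))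
φ*-state (nonSimple m p α) j =
  trans (++-identityʳ _)
        (cong₂ (λ c x → replicate c 0 ++ [ x ]) (sym (perSeq-cycle m p α j)) (nextState-cycle m p j))

tailWord : Parry → ℕ → ℕ → Word
tailWord P i j = φ^ P i (state P j)

tailLen : Parry → ℕ → ℕ → ℕ
tailLen P i j = length (tailWord P i j)

tailWord-suc : ∀ P i j → tailWord P (suc i) j ≡ rep (coeff P j) (φ^ P i [ 0 ]) ++ tailWord P i (suc j)
tailWord-suc P i j = begin
    φ^ P (suc i) (state P j)
  ≡⟨ φ^-suc i (state P j) ⟩
    φ^ P i (φ* P (state P j))
  ≡⟨ cong (φ^ P i) (φ*-state P j) ⟩
    φ^ P i (replicate (coeff P j) 0 ++ state P (suc j))
  ≡⟨ φ^-++ i _ (state P (suc j)) ⟩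
    φ^ P i (replicate (coeff P j) 0) ++ tailWord P i (suc j)
  ≡⟨ cong (λ w → φ^ P i w ++ tailWord P i (suc j)) (rep-[0] (coeff P j)) ⟨
    φ^ P i (rep (coeff P j) [ 0 ]) ++ tailWord P i (suc j)
  ≡⟨ cong (_++ tailWord P i (suc j)) (φ^-rep i (coeff P j) [ 0 ]) ⟩
    rep (coeff P j) (φ^ P i [ 0 ]) ++ tailWord P i (suc j)
  ∎
  where
  open ≡-Reasoning
  open Morphism P

tailLen-suc : ∀ P i j → tailLen P (suc i) j ≡ coeff P j * F P i + tailLen P i (suc j)
tailLen-suc P i j =
  trans (cong length (tailWord-suc P i j))
        (trans (length-++ (rep (coeff P j) (φ^ P i [ 0 ])))
               (cong (_+ tailLen P i (suc j)) (length-rep (coeff P j) (φ^ P i [ 0 ]))))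

module LexBound (g : ℕ → ℕ → ℕ) (s : ℕ → ℕ)
  (g-suc : ∀ i j → g (suc i) j ≡ s j * g i 0 + g i (suc j))
  (g₀-antitone : ∀ x y → x ≤ y → g 0 y ≤ g 0 x)
  (s-lex : ∀ j → 1 ≤ j → LexLt (λ t → s (j + t)) s) where

  agree-suc : ∀ a b n → (∀ t → t < suc n → s (a + t) ≡ s (b + t)) →
              s a ≡ s b × (∀ t → t < n → s (suc a + t) ≡ s (suc b + t))
  agree-suc a b n agr =
    subst₂ (λ x y → s x ≡ s y) (+-identityʳ a) (+-identityʳ b) (agr 0 (s≤s z≤n)) ,
    λ t t<n → subst₂ (λ x y → s x ≡ s y) (+-suc a t) (+-suc b t) (agr (suc t) (s≤s t<n))

  agree-≤ : ∀ i a b → (∀ t → t < i → s (a + t) ≡ s (b + t)) → g 0 (a + i) ≤ g 0 (b + i) → g i a ≤ g i b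
  agree-≤ zero    a b _   base = subst₂ (λ x y → g 0 x ≤ g 0 y) (+-identityʳ a) (+-identityʳ b) base
  agree-≤ (suc i) a b agr base with agree-suc a b i agr
  ... | sa≡sb , agr′ rewrite g-suc i a | g-suc i b =
    +-mono-≤ (≤-reflexive (cong (_* g i 0) sa≡sb))
             (agree-≤ i (suc a) (suc b) agr′ (subst₂ (λ x y → g 0 x ≤ g 0 y) (+-suc a i) (+-suc b i) base))

  differ-≤ : ∀ p r a b → (∀ t → t < p → s (a + t) ≡ s (b + t)) → s (a + p) < s (b + p) →
             g r (a + suc p) ≤ g r 0 → g (suc (p + r)) a ≤ g (suc (p + r)) b
  differ-≤ zero r a b _ sa<sb tail≤ rewrite g-suc r a | g-suc r b = begin
      s a * g r 0 + g r (suc a)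
    ≤⟨ +-monoʳ-≤ (s a * g r 0) (subst (λ x → g r x ≤ g r 0) (+-comm a 1) tail≤) ⟩
      s a * g r 0 + g r 0
    ≡⟨ +-comm (s a * g r 0) (g r 0) ⟩
      suc (s a) * g r 0
    ≤⟨ *-monoˡ-≤ (g r 0) (subst₂ (λ x y → suc (s x) ≤ s y) (+-identityʳ a) (+-identityʳ b) sa<sb) ⟩
      s b * g r 0
    ≤⟨ m≤m+n (s b * g r 0) (g r (suc b)) ⟩
      s b * g r 0 + g r (suc b)
    ∎
    where open ≤-Reasoning
  differ-≤ (suc p) r a b agr sa<sb tail≤ with agree-suc a b p agr
  ... | sa≡sb , agr′ rewrite g-suc (suc (p + r)) a | g-suc (suc (p + r)) b =
    +-mono-≤ (≤-reflexive (cong (_* g (suc (p + r)) 0) sa≡sb))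
             (differ-≤ p r (suc a) (suc b) agr′
                       (subst₂ (λ x y → s x < s y) (+-suc a p) (+-suc b p) sa<sb)
                       (subst (λ x → g r x ≤ g r 0) (+-suc a (suc p)) tail≤))

  -- strong induction on i (bounded by the fuel n)
  bounded : ∀ n i → i ≤ n → ∀ j → g i j ≤ g i 0
  bounded zero    .zero z≤n j = g₀-antitone 0 j z≤n
  bounded (suc n) i     i≤n zero    = ≤-refl
  bounded (suc n) i     i≤n (suc j) with s-lex (suc j) (s≤s z≤n)
  ... | p , agr , differ with i ≤? p
  ...   | yes i≤p = agree-≤ i (suc j) 0 (λ t t<i → agr t (<-≤-trans t<i i≤p))
                            (g₀-antitone i (suc j + i) (m≤n+m i (suc j)))
  ...   | no  i≰p = subst (λ x → g x (suc j) ≤ g x 0) i≡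
                          (differ-≤ p r (suc j) 0 agr differ (bounded n r r≤n (suc j + suc p)))
    where
    r : ℕ
    r = i ∸ suc p
    i≡ : suc (p + r) ≡ i
    i≡ = m+[n∸m]≡n (≰⇒> i≰p)
    r≤n : r ≤ n
    r≤n = ≤-pred (≤-trans (≤-trans (s≤s (m≤n+m r p)) (≤-reflexive i≡)) i≤n)

  bound : ∀ i j → g i j ≤ g i 0
  bound i = bounded i i ≤-refl

record Admissible (P : Parry) : Set where
  field
    state-zero     : state P 0 ≡ [ 0 ]
    state-antitone : ∀ x y → x ≤ y → length (state P y) ≤ length (state P x)
    coeff-lex      : ∀ j → 1 ≤ j → LexLt (λ t → coeff P (j + t)) (coeff P)
    φ0-head        : Σ Word λ Y → φ P 0 ≡ 0 ∷ Y
    F-grows        : ∀ i → F P i < F P (suc i)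

F-grows-if : ∀ P → state P 0 ≡ [ 0 ] → ∀ i → 1 ≤ coeff P 0 → 1 ≤ F P i →
             (2 ≤ coeff P 0 ⊎ 1 ≤ tailLen P i 1) → F P i < F P (suc i)
F-grows-if P λ₀ i c≥1 F≥1 long = subst (F P i <_) (sym F-suc) (grows long)
  where
  open ≤-Reasoning
  c : ℕ
  c = coeff P 0
  Fi : ℕ
  Fi = F P i
  F-suc : F P (suc i) ≡ c * Fi + tailLen P i 1
  F-suc = trans (cong (λ w → length (φ^ P (suc i) w)) (sym λ₀)) (tailLen-suc P i 0)
  Fi≤cFi : Fi ≤ c * Fi
  Fi≤cFi = subst (_≤ c * Fi) (*-identityˡ Fi) (*-monoˡ-≤ Fi c≥1)
  grows : 2 ≤ c ⊎ 1 ≤ tailLen P i 1 → Fi < c * Fi + tailLen P i 1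
  grows (inj₁ c≥2) = begin-strict
      Fi
    <⟨ m<m+n Fi F≥1 ⟩
      Fi + Fi
    ≡⟨ cong (Fi +_) (+-identityʳ Fi) ⟨
      2 * Fi
    ≤⟨ *-monoˡ-≤ Fi c≥2 ⟩
      c * Fi
    ≤⟨ m≤m+n (c * Fi) _ ⟩
      c * Fi + tailLen P i 1
    ∎
  grows (inj₂ T≥1) = begin-strict
      Fi
    <⟨ m<m+n Fi T≥1 ⟩
      Fi + tailLen P i 1
    ≤⟨ +-monoˡ-≤ _ Fi≤cFi ⟩
      c * Fi + tailLen P i 1
    ∎

α₀-positive : ∀ {A B : Set} {a : ℕ} → (2 ≤ a × A) ⊎ (a ≡ 1 × B) → 1 ≤ a
α₀-positive (inj₁ (a≥2 , _)) = ≤-trans (s≤s z≤n) a≥2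
α₀-positive (inj₂ (a≡1 , _)) = ≤-reflexive (sym a≡1)

replicate-head : ∀ c (xs : Word) → 1 ≤ c → Σ Word λ Y → replicate c 0 ++ xs ≡ 0 ∷ Y
replicate-head (suc c) xs _ = replicate c 0 ++ xs , refl

admissible-simple : ∀ m α R → IsParry (simple m α) → AssocConst (simple m α) R → Admissible (simple m α)
admissible-simple (suc m′) α R (_ , α-last≥1 , lex , _) assoc = record
  { state-zero     = refl
  ; state-antitone = antitone
  ; coeff-lex      = coeff-lex
  ; φ0-head        = replicate-head (α 0) _ α0≥1
  ; F-grows        = λ i → F-grows-if P refl i α0≥1 (nonempty i 0 (s≤s z≤n)) (long i)
  }
  where
  m : ℕ
  m = suc m′
  P : Parry
  P = simple m α
  α0≥1 : 1 ≤ α 0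
  α0≥1 = α₀-positive assoc
  antitone : ∀ x y → x ≤ y → length (state P y) ≤ length (state P x)
  antitone x y x≤y with y <ᵇ m | <ᵇ-reflects-< y m
  ... | false | _        = z≤n
  ... | true  | ofʸ y<m = ≤-reflexive (sym (cong length (if-<ᵇ-yes [ x ] [] (≤-<-trans x≤y y<m))))
  -- shifts by j ≥ m start with 0 < α₀
  coeff-lex : ∀ j → 1 ≤ j → LexLt (λ t → coeff P (j + t)) (coeff P)
  coeff-lex j j≥1 with j ≤? m′
  ... | yes j≤m′ = lex j j≥1 j≤m′
  ... | no  j≰m′ = 0 , (λ _ ()) , subst (_< α 0) (sym (if-<ᵇ-no _ 0 (≤-trans (≰⇒> j≰m′) (m≤m+n j 0)))) α0≥1
  nonempty : ∀ i j → j < m → 1 ≤ tailLen P i j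
  nonempty zero    j j<m = ≤-reflexive (sym (cong length (if-<ᵇ-yes [ j ] [] j<m)))
  nonempty (suc i) j j<m rewrite tailLen-suc P i j with suc j <? m
  ... | yes 1+j<m = ≤-trans (nonempty i (suc j) 1+j<m) (m≤n+m _ _)
  ... | no  1+j≮m = ≤-trans (*-mono-≤ c≥1 (nonempty i 0 (s≤s z≤n))) (m≤m+n _ _)
    where
    j≡m′ : j ≡ m′
    j≡m′ = ≤-antisym (≤-pred j<m) (≤-pred (≮⇒≥ 1+j≮m))
    c≥1 : 1 ≤ finSeq m α j
    c≥1 = subst (1 ≤_) (sym (trans (if-<ᵇ-yes _ _ j<m) (cong α j≡m′))) α-last≥1
  -- if α₀ = 1 then some α_ℓ′ with 1 ≤ ℓ′ < m is positive, so m ≥ 2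
  long-if : AssocConst P R → ∀ i → 2 ≤ α 0 ⊎ 1 ≤ tailLen P i 1
  long-if (inj₁ (α0≥2 , _))                      i = inj₁ α0≥2
  long-if (inj₂ (_ , _ , (ℓ′≥1 , ℓ′<m , _) , _)) i = inj₂ (nonempty i 1 (≤-trans (s≤s ℓ′≥1) ℓ′<m))
  long : ∀ i → 2 ≤ α 0 ⊎ 1 ≤ tailLen P i 1
  long = long-if assoc

admissible-nonSimple : ∀ m p .{{_ : NonZero p}} α R →
  IsParry (nonSimple m p α) → AssocConst (nonSimple m p α) R → Admissible (nonSimple m p α)
admissible-nonSimple (suc m′) p α R (_ , _ , _ , lex) (_ , _ , small-or-one) = record
  { state-zero     = refl
  ; state-antitone = λ _ _ _ → ≤-refl
  ; coeff-lex      = lex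
  ; φ0-head        = replicate-head (α 0) _ α0≥1
  ; F-grows        = λ i → F-grows-if P refl i α0≥1 (nonempty i 0) (inj₂ (nonempty i 1))
  }
  where
  P : Parry
  P = nonSimple (suc m′) p α
  α0≥1 : 1 ≤ α 0
  α0≥1 = α₀-positive small-or-one
  nonempty : ∀ i j → 1 ≤ tailLen P i j
  nonempty zero    j = ≤-refl
  nonempty (suc i) j rewrite tailLen-suc P i j = ≤-trans (nonempty i (suc j)) (m≤n+m _ _)

admissible : ∀ P R → IsParry P → AssocConst P R → Admissible P
admissible (simple m α)      R isP assoc = admissible-simple m α R isP assoc
admissible (nonSimple m p α) R isP assoc = admissible-nonSimple m p α R isP assoc

expand : Parry → ℕ → List ℕ → Word
expand P b []       = []
expand P b (d ∷ ds) = rep d (φ^ P (b + length ds) [ 0 ]) ++ expand P b ds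

greedy-length : ∀ {P N x ds} → Greedy P N x ds → length ds ≡ N
greedy-length done           = refl
greedy-length (step _ _ gds) = cong suc (greedy-length gds)

digit-≤ : ∀ {d s F T t} → d * F ≤ t → t < s * F + T → T ≤ F → d ≤ s
digit-≤ {d} {s} {F} {T} {t} dF≤t t<sF+T T≤F = ≮⇒≥ s<d-absurd
  where
  s<d-absurd : s < d → _
  s<d-absurd s<d = <⇒≱ (<-≤-trans t<sF+T (≤-trans (+-monoʳ-≤ (s * F) T≤F) (≤-reflexive (+-comm (s * F) F))))
                        (≤-trans (*-monoˡ-≤ F s<d) dF≤t)

module Numeration (P : Parry) (adm : Admissible P) where
  open Admissible adm
  open Morphism P

  tailWord-zero : ∀ i → tailWord P i 0 ≡ φ^ P i [ 0 ]
  tailWord-zero i = cong (φ^ P i) state-zero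

  open LexBound (tailLen P) (coeff P)
    (λ i j → trans (tailLen-suc P i j) (cong (λ x → coeff P j * x + tailLen P i (suc j)) (sym (cong length (tailWord-zero i)))))
    state-antitone coeff-lex
    using (bound)

  tail-≤-F : ∀ i j → tailLen P i j ≤ F P i
  tail-≤-F i j = subst (tailLen P i j ≤_) (cong length (tailWord-zero i)) (bound i j)

  -- F_i ≥ i + 1, so u_[n] = take n φ^n(0) really has length n
  F-large : ∀ i → suc i ≤ F P i
  F-large zero    = ≤-refl
  F-large (suc i) = ≤-trans (s≤s (F-large i)) (F-grows i)

  -- φ^c(0) starts with 0, hence φ^a(0) is a prefix of φ^{a+c}(0)
  φ^-head : ∀ c → Σ Word λ Y → φ^ P c [ 0 ] ≡ 0 ∷ Y
  φ^-head zero = [] , refl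
  φ^-head (suc c) with φ^-head c | φ0-head
  ... | X , eX | Y , eY = X ++ φ^ P c Y ,
    trans (φ^-suc c [ 0 ]) (trans (cong (φ^ P c) (trans (++-identityʳ (φ P 0)) eY))
                                  (trans (φ^-++ c [ 0 ] Y) (cong (_++ φ^ P c Y) eX)))

  φ^-prefix : ∀ a c → Σ Word λ X → φ^ P (a + c) [ 0 ] ≡ φ^ P a [ 0 ] ++ X
  φ^-prefix a c with φ^-head c
  ... | Y , eY = φ^ P a Y , trans (sym (φ^-+ a c [ 0 ])) (trans (cong (φ^ P a) eY) (φ^-++ a [ 0 ] Y))

  take-φ^-≤ : ∀ n a b → a ≤ b → n ≤ F P a → take n (φ^ P b [ 0 ]) ≡ take n (φ^ P a [ 0 ])
  take-φ^-≤ n a b a≤b n≤Fa with φ^-prefix a (b ∸ a)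
  ... | X , eX = trans (cong (λ y → take n (φ^ P y [ 0 ])) (sym (m+[n∸m]≡n a≤b)))
                       (trans (cong (take n) eX) (take-++-short (φ^ P a [ 0 ]) X n n≤Fa))

  pref-as-take : ∀ n a → n ≤ F P a → pref P n ≡ take n (φ^ P a [ 0 ])
  pref-as-take n a n≤Fa with ≤-total n a
  ... | inj₁ n≤a = sym (take-φ^-≤ n n a n≤a (≤-trans (n≤1+n n) (F-large n)))
  ... | inj₂ a≤n = take-φ^-≤ n a n a≤n n≤Fa

  length-pref : ∀ n → length (pref P n) ≡ n
  length-pref n = trans (length-take n (φ^ P n [ 0 ])) (m≤n⇒m⊓n≡m (≤-trans (n≤1+n n) (F-large n)))

  -- φ^a(0) being a prefix of φ^b(0), F is monotone
  F-mono : ∀ a b → a ≤ b → F P a ≤ F P b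
  F-mono a b a≤b with φ^-prefix a (b ∸ a)
  ... | X , eX = subst (λ y → F P a ≤ F P y) (m+[n∸m]≡n a≤b)
                       (subst (F P a ≤_) (sym (trans (cong length eX) (length-++ (φ^ P a [ 0 ])))) (m≤m+n _ _))

  greedy-prefix : ∀ {N t ds} → Greedy P N t ds → ∀ j → t < tailLen P N j → take t (tailWord P N j) ≡ expand P 0 ds
  greedy-prefix {t = zero}  done j _ = refl
  greedy-prefix {t = suc t} done j t<T with ≤-trans t<T (tail-≤-F 0 j)
  ... | s≤s ()
  greedy-prefix (step {i} {t} {d} {ds} dF≤t t<F+dF gds) j t<T with d <? coeff P j
  ... | yes d<s = begin
      take t (tailWord P (suc i) j)
    ≡⟨ cong₂ take (sym t≡) (tailWord-suc P i j) ⟩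
      take (d * F P i + r) (rep (coeff P j) W ++ tailWord P i (suc j))
    ≡⟨ take-rep-inside d (coeff P j) W _ r d<s (<⇒≤ r<F) ⟩
      rep d W ++ take r W
    ≡⟨ cong₂ (λ a w → rep d (φ^ P a [ 0 ]) ++ take r w) (sym (greedy-length gds)) (sym (tailWord-zero i)) ⟩
      rep d (φ^ P (length ds) [ 0 ]) ++ take r (tailWord P i 0)
    ≡⟨ cong (rep d (φ^ P (length ds) [ 0 ]) ++_) (greedy-prefix gds 0 (subst (r <_) (cong length (sym (tailWord-zero i))) r<F)) ⟩
      expand P 0 (d ∷ ds)
    ∎
    where
    open ≡-Reasoning
    W : Word
    W = φ^ P i [ 0 ]
    r : ℕ
    r = t ∸ d * F P i
    t≡ : d * F P i + r ≡ t
    t≡ = m+[n∸m]≡n dF≤t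
    r<F : r < F P i
    r<F = +-cancelˡ-< (d * F P i) r (F P i) (subst₂ _<_ (sym t≡) (+-comm (F P i) (d * F P i)) t<F+dF)
  ... | no d≮s with ≤-antisym (digit-≤ dF≤t (subst (t <_) (tailLen-suc P i j) t<T) (tail-≤-F i (suc j))) (≮⇒≥ d≮s)
  ...   | refl = begin
      take t (tailWord P (suc i) j)
    ≡⟨ cong₂ take (sym t≡) (tailWord-suc P i j) ⟩
      take (d * F P i + r) (rep d W ++ tailWord P i (suc j))
    ≡⟨ take-rep-after d W _ r ⟩
      rep d W ++ take r (tailWord P i (suc j))
    ≡⟨ cong₂ (λ a w → rep d (φ^ P a [ 0 ]) ++ w) (sym (greedy-length gds)) (greedy-prefix gds (suc j) r<T) ⟩
      expand P 0 (d ∷ ds)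
    ∎
    where
    open ≡-Reasoning
    W : Word
    W = φ^ P i [ 0 ]
    r : ℕ
    r = t ∸ d * F P i
    t≡ : d * F P i + r ≡ t
    t≡ = m+[n∸m]≡n dF≤t
    r<T : r < tailLen P i (suc j)
    r<T = +-cancelˡ-< (d * F P i) r _ (subst₂ _<_ (sym t≡) (tailLen-suc P i j) t<T)

  pref-normal : ∀ n ds → NormalRep P n ds → pref P n ≡ expand P 0 ds
  pref-normal n ds (n<F , gds) = begin
      pref P n
    ≡⟨ pref-as-take n (length ds) (<⇒≤ n<F) ⟩
      take n (φ^ P (length ds) [ 0 ])
    ≡⟨ cong (take n) (tailWord-zero (length ds)) ⟨
      take n (tailWord P (length ds) 0)
    ≡⟨ greedy-prefix gds 0 (subst (n <_) (cong length (sym (tailWord-zero (length ds)))) n<F) ⟩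
      expand P 0 ds
    ∎
    where open ≡-Reasoning

  expand-++ : ∀ b hi lo → expand P b (hi ++ lo) ≡ expand P (b + length lo) hi ++ expand P b lo
  expand-++ b []       lo = refl
  expand-++ b (d ∷ hi) lo =
    trans (cong₂ (λ x y → rep d (φ^ P x [ 0 ]) ++ y) level (expand-++ b hi lo))
          (sym (++-assoc (rep d (φ^ P (b + length lo + length hi) [ 0 ])) _ _))
    where
    level : b + length (hi ++ lo) ≡ b + length lo + length hi
    level = trans (cong (b +_) (trans (length-++ hi) (+-comm (length hi) (length lo)))) (sym (+-assoc b (length lo) (length hi)))

  φ^-expand : ∀ k ds → φ^ P k (expand P 0 ds) ≡ expand P k ds
  φ^-expand k []       = φ^-[] k
  φ^-expand k (d ∷ ds) =
    trans (φ^-++ k _ _) (cong₂ _++_ (trans (φ^-rep k d _) (cong (rep d) (φ^-+ k (length ds) [ 0 ]))) (φ^-expand k ds))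

  pref-split : ∀ n Q q k hi lo → length lo ≡ k →
               NormalRep P n (hi ++ lo) → NormalRep P Q hi → NormalRep P q lo →
               pref P n ≡ φ^ P k (pref P Q) ++ pref P q
  pref-split n Q q k hi lo refl rep-n rep-Q rep-q = begin
      pref P n
    ≡⟨ pref-normal n (hi ++ lo) rep-n ⟩
      expand P 0 (hi ++ lo)
    ≡⟨ expand-++ 0 hi lo ⟩
      expand P (length lo) hi ++ expand P 0 lo
    ≡⟨ cong₂ _++_ (trans (sym (φ^-expand (length lo) hi)) (cong (φ^ P (length lo)) (sym (pref-normal Q hi rep-Q))))
                  (sym (pref-normal q lo rep-q)) ⟩
      φ^ P (length lo) (pref P Q) ++ pref P q
    ∎
    where open ≡-Reasoning

CoDecOfImage : Parry → ℕ → ℕ → Word → (Word × Word) → List (Word × Word) → Set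
CoDecOfImage P k q V zz D = IsCoDec (φ^ P k (proj₁ zz)) (drop q (φ^ P k (proj₂ zz) ++ V)) D

concat-map-++ : ∀ (π : Word × Word → Word) (D E : List (Word × Word)) →
                concat (map π (D ++ E)) ≡ concat (map π D) ++ concat (map π E)
concat-map-++ π D E = trans (cong concat (map-++ π D E)) (sym (concat-++ (map π D) (map π E)))

Pieces : List (Word × Word) → Set
Pieces D = All (λ zz → NonEmpty (proj₁ zz) × NonEmpty (proj₂ zz) × ParikhEq (proj₁ zz) (proj₂ zz)) D

module Glue (f₁ f₂ : Word × Word → Word) where

  glue-parts : ∀ Z Ds → Pointwise (λ zz D → IsCoDec (f₁ zz) (f₂ zz) D) Z Ds →
               concat (map proj₁ (concat Ds)) ≡ concat (map f₁ Z)
               × concat (map proj₂ (concat Ds)) ≡ concat (map f₂ Z)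
               × Pieces (concat Ds)
  glue-parts []       []       []         = refl , refl , []
  glue-parts (zz ∷ Z) (D ∷ Ds) (cD ∷ cDs) with cD | glue-parts Z Ds cDs
  ... | _ , e₁ , e₂ , ok | e₁s , e₂s , oks =
    trans (concat-map-++ proj₁ D (concat Ds)) (cong₂ _++_ e₁ e₁s) ,
    trans (concat-map-++ proj₂ D (concat Ds)) (cong₂ _++_ e₂ e₂s) ,
    All.++⁺ ok oks

  glue : ∀ Z Ds → 1 ≤ length Z → Pointwise (λ zz D → IsCoDec (f₁ zz) (f₂ zz) D) Z Ds →
         IsCoDec (concat (map f₁ Z)) (concat (map f₂ Z)) (concat Ds)
  glue (zz ∷ Z) (D ∷ Ds) _ (cD ∷ cDs) =
    ≤-trans (proj₁ cD) (subst (length D ≤_) (sym (length-++ D)) (m≤m+n _ _)) , glue-parts (zz ∷ Z) (D ∷ Ds) (cD ∷ cDs)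

module Image (P : Parry) (k q : ℕ) (V : Word) (|V| : length V ≡ q) where
  open Morphism P
  open Permute P

  conjugated : Word × Word → Word
  conjugated zz = drop q (φ^ P k (proj₂ zz) ++ V)

  conjugate-parikh : ∀ z z̃ → ParikhEq z z̃ → IsPrefix V (φ^ P k z̃) → ParikhEq (φ^ P k z) (conjugated (z , z̃))
  conjugate-parikh z z̃ z~z̃ (s , Vs≡) =
    subst (ParikhEq (φ^ P k z)) (sym (drop-conjugate V s _ q |V| Vs≡))
      (↭⇒ParikhEq (↭-trans (φ^-↭ k (ParikhEq⇒↭ z z̃ z~z̃)) (↭-trans (↭-reflexive (sym Vs≡)) (++-comm V s))))

  telescope : ∀ (Z : List (Word × Word)) → All (λ zz → IsPrefix V (φ^ P k (proj₂ zz))) Z →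
              V ++ concat (map conjugated Z) ≡ φ^ P k (concat (map proj₂ Z)) ++ V
  telescope [] [] = trans (++-identityʳ V) (cong (_++ V) (sym (φ^-[] k)))
  telescope ((z , z̃) ∷ Z) ((s , Vs≡) ∷ pre) = begin
      V ++ (conjugated (z , z̃) ++ rest)
    ≡⟨ cong (λ x → V ++ (x ++ rest)) (drop-conjugate V s _ q |V| Vs≡) ⟩
      V ++ ((s ++ V) ++ rest)
    ≡⟨ cong (V ++_) (++-assoc s V rest) ⟩
      V ++ (s ++ (V ++ rest))
    ≡⟨ ++-assoc V s (V ++ rest) ⟨
      (V ++ s) ++ (V ++ rest)
    ≡⟨ cong₂ _++_ Vs≡ (telescope Z pre) ⟩
      φ^ P k z̃ ++ (φ^ P k (concat (map proj₂ Z)) ++ V)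
    ≡⟨ ++-assoc (φ^ P k z̃) _ V ⟨
      (φ^ P k z̃ ++ φ^ P k (concat (map proj₂ Z))) ++ V
    ≡⟨ cong (_++ V) (φ^-++ k z̃ _) ⟨
      φ^ P k (z̃ ++ concat (map proj₂ Z)) ++ V
    ∎
    where
    open ≡-Reasoning
    rest : Word
    rest = concat (map conjugated Z)

  φ^-concat-map : ∀ (Z : List (Word × Word)) → concat (map (λ zz → φ^ P k (proj₁ zz)) Z) ≡ φ^ P k (concat (map proj₁ Z))
  φ^-concat-map []       = sym (φ^-[] k)
  φ^-concat-map (zz ∷ Z) = trans (cong (φ^ P k (proj₁ zz) ++_) (φ^-concat-map Z)) (sym (φ^-++ k (proj₁ zz) _))

  image-codec : ∀ X Y Z → IsCoDec X Y Z → All (λ zz → IsPrefix V (φ^ P k (proj₂ zz))) Z →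
                All (λ zz → ParikhEq (φ^ P k (proj₁ zz)) (conjugated zz)) Z
                × (∀ Ds → Pointwise (CoDecOfImage P k q V) Z Ds → IsCoDec (φ^ P k X) (drop q (φ^ P k Y ++ V)) (concat Ds))
  image-codec X Y Z (Z≥1 , refl , refl , pieces) pre = parikh Z pieces pre , glued
    where
    parikh : ∀ Z → Pieces Z → All (λ zz → IsPrefix V (φ^ P k (proj₂ zz))) Z →
             All (λ zz → ParikhEq (φ^ P k (proj₁ zz)) (conjugated zz)) Z
    parikh []            []                  []         = []
    parikh ((z , z̃) ∷ Z) ((_ , _ , eq) ∷ ps) (Vs ∷ pre) = conjugate-parikh z z̃ eq Vs ∷ parikh Z ps pre
    conjugated-concat : concat (map conjugated Z) ≡ drop q (φ^ P k Y ++ V)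
    conjugated-concat = trans (sym (drop-++-exact V _ q |V|)) (cong (drop q) (telescope Z pre))
    glued : ∀ Ds → Pointwise (CoDecOfImage P k q V) Z Ds → IsCoDec (φ^ P k X) (drop q (φ^ P k Y ++ V)) (concat Ds)
    glued Ds cDs = subst₂ (λ a b → IsCoDec a b (concat Ds)) (φ^-concat-map Z) conjugated-concat
                          (Glue.glue (λ zz → φ^ P k (proj₁ zz)) conjugated Z Ds Z≥1 cDs)

-- Proposition 5.1: apply image-codec to X = W, Y = U⁻¹WU, and identify the result
-- using u_[n] = φ^k(U)V and φ^{k+K+R}(0) = φ^k(W).
proposition5p1 : (P : Parry) → IsParry P → (R : ℕ) → AssocConst P R →
    (n k K : ℕ) → 1 ≤ k → 1 ≤ K →
    (hi lo : List ℕ) → length hi ≡ K → length lo ≡ k →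
    NormalRep P n (hi ++ lo) →
    (Q q : ℕ) → NormalRep P Q hi → NormalRep P q lo →
    (Z : List (Word × Word)) →
    IsCoDec (φ^ P (K + R) [ 0 ]) (drop Q (φ^ P (K + R) [ 0 ] ++ pref P Q)) Z →
    All (λ zz → IsPrefix (pref P q) (φ^ P k (proj₂ zz))) Z →
    All (λ zz → ParikhEq (φ^ P k (proj₁ zz))
                         (drop q (φ^ P k (proj₂ zz) ++ pref P q))) Z
    × ((Ds : List (List (Word × Word))) →
       Pointwise (λ zz D → IsCoDec (φ^ P k (proj₁ zz))
                                   (drop q (φ^ P k (proj₂ zz) ++ pref P q)) D) Z Ds →
       IsCoDec (φ^ P (k + K + R) [ 0 ])
               (drop n (φ^ P (k + K + R) [ 0 ] ++ pref P n)) (concat Ds))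
proposition5p1 P isP R assoc n k K _ _ hi lo refl refl rep-n Q q rep-Q rep-q Z codec pre =
  proj₁ image , λ Ds cDs → subst₂ (λ a b → IsCoDec a b (concat Ds)) (sym whole) (sym conjugate) (proj₂ image Ds cDs)
  where
  open Numeration P (admissible P R isP assoc)
  open Morphism P
  open ≡-Reasoning
  W : Word
  W = φ^ P (K + R) [ 0 ]
  U : Word
  U = pref P Q
  V : Word
  V = pref P q
  image : All (λ zz → ParikhEq (φ^ P k (proj₁ zz)) (drop q (φ^ P k (proj₂ zz) ++ V))) Z
          × (∀ Ds → Pointwise (CoDecOfImage P k q V) Z Ds →
                    IsCoDec (φ^ P k W) (drop q (φ^ P k (drop Q (W ++ U)) ++ V)) (concat Ds))
  image = Image.image-codec P k q V (length-pref q) W (drop Q (W ++ U)) Z codec pre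
  -- U = u_[Q] is a prefix of W, since Q < F_K ≤ F_{K+R}
  W-split : U ++ drop Q W ≡ W
  W-split = trans (cong (_++ drop Q W) (pref-as-take Q (K + R) (≤-trans (<⇒≤ (proj₁ rep-Q)) (F-mono K (K + R) (m≤m+n K R)))))
                  (take++drop≡id Q W)
  u-n : pref P n ≡ φ^ P k U ++ V
  u-n = pref-split n Q q k hi lo refl rep-n rep-Q rep-q
  whole : φ^ P (k + K + R) [ 0 ] ≡ φ^ P k W
  whole = trans (cong (λ x → φ^ P x [ 0 ]) (+-assoc k K R)) (sym (φ^-+ k (K + R) [ 0 ]))
  n≡ : n ≡ length (φ^ P k U) + length V
  n≡ = trans (sym (length-pref n)) (trans (cong length u-n) (length-++ (φ^ P k U)))
  conjugate : drop n (φ^ P (k + K + R) [ 0 ] ++ pref P n) ≡ drop q (φ^ P k (drop Q (W ++ U)) ++ V)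
  conjugate = begin
      drop n (φ^ P (k + K + R) [ 0 ] ++ pref P n)
    ≡⟨ cong₂ (λ a b → drop n (a ++ b)) (trans whole (trans (cong (φ^ P k) (sym W-split)) (φ^-++ k U (drop Q W)))) u-n ⟩
      drop n ((φ^ P k U ++ φ^ P k (drop Q W)) ++ (φ^ P k U ++ V))
    ≡⟨ drop-rotate (φ^ P k U) _ V n n≡ ⟩
      drop (length V) ((φ^ P k (drop Q W) ++ φ^ P k U) ++ V)
    ≡⟨ cong₂ (λ l w → drop l (w ++ V)) (length-pref q) (sym (φ^-++ k (drop Q W) U)) ⟩
      drop q (φ^ P k (drop Q W ++ U) ++ V)
    ≡⟨ cong (λ w → drop q (φ^ P k w ++ V)) (drop-conjugate U (drop Q W) W Q (length-pref Q) W-split) ⟨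
      drop q (φ^ P k (drop Q (W ++ U)) ++ V)
    ∎
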